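{- Let $\Gamma$ be a nested sequent (in the sense of the context). If $\Gamma$ is derivable in the nested calculus $\mathsf{N.IntCK}$, then its formula interpretation $i(\Gamma)$ is derivable in the Hilbert system $\mathsf{IntCK}$.
   Context: Language $\mathcal{L}$: formulas $\varphi ::= p \mid \bot \mid \varphi\wedge\varphi \mid \varphi\vee\varphi \mid \varphi\to\varphi \mid \varphi \mathbin{\Box\!\!\rightarrow} \varphi \mid \varphi \mathbin{\Diamond\!\!\rightarrow}\varphi$, $p$ ranging over a countable set of atoms; $\wedge,\vee$ bind more strongly than $\to,\mathbin{\Box\!\!\rightarrow},\mathbin{\Diamond\!\!\rightarrow}$; $\neg\varphi:=\varphi\to\bot$, $\top:=\neg\bot$, $\varphi\leftrightarrow\psi:=(\varphi\to\psi)\wedge(\psi\to\varphi)$. $\mathsf{IntCK}$ is the Hilbert system extending an axiomatisation of intuitionistic propositional logic in $\mathcal{L}$ (with modus ponens) by the axioms CM$_\Box$: $(\varphi\mathbin{\Box\!\!\rightarrow}\psi\wedge\chi)\to(\varphi\mathbin{\Box\!\!\rightarrow}\psi)\wedge(\varphi\mathbin{\Box\!\!\rightarrow}\chi)$; CC$_\Box$: $(\varphi\mathbin{\Box\!\!\rightarrow}\psi)\wedge(\varphi\mathbin{\Box\!\!\rightarrow}\chi)\to(\varphi\mathbin{\Box\!\!\rightarrow}\psi\wedge\chi)$; CN$_\Box$: $\varphi\mathbin{\Box\!\!\rightarrow}\top$; CM$_\Diamond$: $(\varphi\mathbin{\Diamond\!\!\rightarrow}\psi)\vee(\varphi\mathbin{\Diamond\!\!\rightarrow}\chi)\to(\varphi\mathbin{\Diamond\!\!\rightarrow}\psi\vee\chi)$;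 CC$_\Diamond$: $(\varphi\mathbin{\Diamond\!\!\rightarrow}\psi\vee\chi)\to(\varphi\mathbin{\Diamond\!\!\rightarrow}\psi)\vee(\varphi\mathbin{\Diamond\!\!\rightarrow}\chi)$; CN$_\Diamond$: $\neg(\varphi\mathbin{\Diamond\!\!\rightarrow}\bot)$; CW: $(\varphi\mathbin{\Diamond\!\!\rightarrow}\psi)\wedge(\varphi\mathbin{\Box\!\!\rightarrow}\chi)\to(\varphi\mathbin{\Diamond\!\!\rightarrow}\psi\wedge\chi)$; CFS: $((\varphi\mathbin{\Diamond\!\!\rightarrow}\psi)\to(\varphi\mathbin{\Box\!\!\rightarrow}\chi))\to(\varphi\mathbin{\Box\!\!\rightarrow}(\psi\to\chi))$; and the rules RA$_\Box$: from $\varphi\leftrightarrow\rho$ infer $(\varphi\mathbin{\Box\!\!\rightarrow}\psi)\leftrightarrow(\rho\mathbin{\Box\!\!\rightarrow}\psi)$; RC$_\Box$: from $\psi\leftrightarrow\chi$ infer $(\varphi\mathbin{\Box\!\!\rightarrow}\psi)\leftrightarrow(\varphi\mathbin{\Box\!\!\rightarrow}\chi)$; RA$_\Diamond$, RC$_\Diamond$: the same with $\mathbin{\Diamond\!\!\rightarrow}$ in place of $\mathbin{\Box\!\!\rightarrow}$. Nested sequents: for each $\varphi\in\mathcal{L}$ there is an input formula $\bullet\varphi$ and an output formula $\circ\varphi$. Input sequents $\Lambda ::= \emptyset \mid \Lambda,\bullet\varphi \mid \Lambda,[\psi:\Lambda']$; nested sequents $\Gamma ::= \Lambda,\circ\varphi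 \mid \Lambda,[\psi:\Gamma']$, where $\psi\in\mathcal{L}$ (unpolarised) is the index of the component, and comma is multiset union. So a nested sequent contains exactly one output formula. Formula interpretation: $i(\emptyset)=\top$, $i(\Lambda,\bullet\varphi)=i(\Lambda)\wedge\varphi$, $i(\Lambda,[\psi:\Lambda'])=i(\Lambda)\wedge(\psi\mathbin{\Diamond\!\!\rightarrow} i(\Lambda'))$, $i(\Lambda,\circ\varphi)=i(\Lambda)\to\varphi$, $i(\Lambda,[\psi:\Gamma])=i(\Lambda)\to(\psi\mathbin{\Box\!\!\rightarrow} i(\Gamma))$. A context $\Gamma\{\,\}$ is built by: $\{\,\}$ is a context; if $\Delta$ is a (input or nested) sequent and $\Gamma\{\,\}$ a context, then $\Delta,\Gamma\{\,\}$ and $[\varphi:\Gamma\{\,\}]$ are contexts. $\Gamma\{\Sigma\}$ is the result of filling the hole with $\Sigma$; only fillings yielding input or nested sequents are allowed (a context already containing an output formula can only be filled with an input sequent). $\Gamma^{\downarrow}\{\,\}$ is $\Gamma\{\,\}$ with its output formula (if any) deleted. Rules of $\mathsf{N.IntCK}$ (premisses / conclusion): init: $\Gamma\{\bullet p,\circ p\}$ (no premiss); $\bot^\bullet$: $\Gamma\{\bullet\bot\}$ (no premiss); $\wedge^\bullet$: $\Gamma\{\bullet\varphi,\bullet\psi\}$ / $\Gamma\{\bullet(\varphi\wedge\psi)\}$; $\wedge^\circ$: $\Gamma\{\circ\varphi\}$, $\Gamma\{\circ\psi\}$ / $\Gamma\{\circ(\varphi\wedge\psi)\}$; $\vee^\bullet$: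 $\Gamma\{\bullet\varphi\}$, $\Gamma\{\bullet\psi\}$ / $\Gamma\{\bullet(\varphi\vee\psi)\}$; $\vee^\circ$: $\Gamma\{\circ\varphi\}$ / $\Gamma\{\circ(\varphi\vee\psi)\}$ and $\Gamma\{\circ\psi\}$ / $\Gamma\{\circ(\varphi\vee\psi)\}$; $\to^\bullet$: $\Gamma^\downarrow\{\bullet(\varphi\to\psi),\circ\varphi\}$, $\Gamma\{\bullet\psi\}$ / $\Gamma\{\bullet(\varphi\to\psi)\}$; $\to^\circ$: $\Gamma\{\bullet\varphi,\circ\psi\}$ / $\Gamma\{\circ(\varphi\to\psi)\}$; $\Box^\bullet$: $\bullet\varphi,\circ\eta$; $\bullet\eta,\circ\varphi$; $\Gamma\{\bullet(\varphi\mathbin{\Box\!\!\rightarrow}\psi),[\eta:\bullet\psi,\Delta]\}$ / $\Gamma\{\bullet(\varphi\mathbin{\Box\!\!\rightarrow}\psi),[\eta:\Delta]\}$; $\Box^\circ$: $\Gamma\{[\varphi:\circ\psi]\}$ / $\Gamma\{\circ(\varphi\mathbin{\Box\!\!\rightarrow}\psi)\}$; $\Diamond^\bullet$: $\Gamma\{[\varphi:\bullet\psi]\}$ / $\Gamma\{\bullet(\varphi\mathbin{\Diamond\!\!\rightarrow}\psi)\}$; $\Diamond^\circ$: $\bullet\varphi,\circ\eta$; $\bullet\eta,\circ\varphi$; $\Gamma\{[\eta:\circ\psi,\Delta]\}$ / $\Gamma\{\circ(\varphi\mathbin{\Diamond\!\!\rightarrow}\psi),[\eta:\Delta]\}$.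 A derivation of $\Gamma$ is a finite tree rooted at $\Gamma$, whose leaves are instances of init or $\bot^\bullet$ and whose inner nodes follow from their children by a rule. -}

module Defs where

open import Data.Nat using (ℕ)
open import Data.List using (List; []; _∷_; _++_)
open import Relation.Binary.PropositionalEquality using (_≡_)

infixr 6 _∧'_
infixr 5 _∨'_
infixr 4 _⇒_ _□→_ _◇→_

data Fml : Set where
  atom   : ℕ → Fml
  falsum : Fml
  _∧'_   : Fml → Fml → Fml
  _∨'_   : Fml → Fml → Fml
  _⇒_    : Fml → Fml → Fml
  _□→_   : Fml → Fml → Fml
  _◇→_   : Fml → Fml → Fml

¬'_ : Fml → Fml
¬' φ = φ ⇒ falsum

⊤' : Fml
⊤' = ¬' falsum

_⇔_ : Fml → Fml → Fml
φ ⇔ ψ = (φ ⇒ ψ) ∧' (ψ ⇒ φ)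

data ⊢_ : Fml → Set where
  ipc1 : ∀ {φ ψ} → ⊢ (φ ⇒ (ψ ⇒ φ))
  ipc2 : ∀ {φ ψ χ} → ⊢ ((φ ⇒ (ψ ⇒ χ)) ⇒ ((φ ⇒ ψ) ⇒ (φ ⇒ χ)))
  ipc3 : ∀ {φ ψ} → ⊢ (φ ∧' ψ ⇒ φ)
  ipc4 : ∀ {φ ψ} → ⊢ (φ ∧' ψ ⇒ ψ)
  ipc5 : ∀ {φ ψ} → ⊢ (φ ⇒ (ψ ⇒ φ ∧' ψ))
  ipc6 : ∀ {φ ψ} → ⊢ (φ ⇒ φ ∨' ψ)
  ipc7 : ∀ {φ ψ} → ⊢ (ψ ⇒ φ ∨' ψ)
  ipc8 : ∀ {φ ψ χ} → ⊢ ((φ ⇒ χ) ⇒ ((ψ ⇒ χ) ⇒ (φ ∨' ψ ⇒ χ)))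
  ipc9 : ∀ {φ} → ⊢ (falsum ⇒ φ)
  mp   : ∀ {φ ψ} → ⊢ (φ ⇒ ψ) → ⊢ φ → ⊢ ψ
  CM□  : ∀ {φ ψ χ} → ⊢ ((φ □→ ψ ∧' χ) ⇒ (φ □→ ψ) ∧' (φ □→ χ))
  CC□  : ∀ {φ ψ χ} → ⊢ ((φ □→ ψ) ∧' (φ □→ χ) ⇒ (φ □→ ψ ∧' χ))
  CN□  : ∀ {φ} → ⊢ (φ □→ ⊤')
  CM◇  : ∀ {φ ψ χ} → ⊢ ((φ ◇→ ψ) ∨' (φ ◇→ χ) ⇒ (φ ◇→ ψ ∨' χ))
  CC◇  : ∀ {φ ψ χ} → ⊢ ((φ ◇→ ψ ∨' χ) ⇒ (φ ◇→ ψ) ∨' (φ ◇→ χ))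
  CN◇  : ∀ {φ} → ⊢ (¬' (φ ◇→ falsum))
  CW   : ∀ {φ ψ χ} → ⊢ ((φ ◇→ ψ) ∧' (φ □→ χ) ⇒ (φ ◇→ ψ ∧' χ))
  CFS  : ∀ {φ ψ χ} → ⊢ (((φ ◇→ ψ) ⇒ (φ □→ χ)) ⇒ (φ □→ (ψ ⇒ χ)))
  RA□  : ∀ {φ ρ ψ} → ⊢ (φ ⇔ ρ) → ⊢ ((φ □→ ψ) ⇔ (ρ □→ ψ))
  RC□  : ∀ {φ ψ χ} → ⊢ (ψ ⇔ χ) → ⊢ ((φ □→ ψ) ⇔ (φ □→ χ))
  RA◇  : ∀ {φ ρ ψ} → ⊢ (φ ⇔ ρ) → ⊢ ((φ ◇→ ψ) ⇔ (ρ ◇→ ψ))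
  RC◇  : ∀ {φ ψ χ} → ⊢ (ψ ⇔ χ) → ⊢ ((φ ◇→ ψ) ⇔ (φ ◇→ χ))

-- Sequent structures.  A (pre)sequent is a list of items; comma is
-- list concatenation, and multiset-ness is handled by the exchange
-- relation _≋_ below (permutation at every nesting level).

mutual
  data Item : Set where
    •_    : Fml → Item
    ∘_    : Fml → Item
    [_∶_] : Fml → Seq → Item

  Seq : Set
  Seq = List Item

data IsInput : Seq → Set where
  []   : IsInput []
  •∷   : ∀ {φ Λ} → IsInput Λ → IsInput (• φ ∷ Λ)
  []∷  : ∀ {ψ Λ' Λ} → IsInput Λ' → IsInput Λ → IsInput ([ ψ ∶ Λ' ] ∷ Λ)

-- Nested sequents  Γ ::= Λ,∘φ | Λ,[ψ:Γ']  (comma = multiset union, so the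
-- output-carrying item may sit anywhere in the list)
data IsNested : Seq → Set where
  here∘  : ∀ {φ Λ} → IsInput Λ → IsNested (∘ φ ∷ Λ)
  here[] : ∀ {ψ Γ' Λ} → IsNested Γ' → IsInput Λ → IsNested ([ ψ ∶ Γ' ] ∷ Λ)
  there• : ∀ {φ Γ} → IsNested Γ → IsNested (• φ ∷ Γ)
  there[] : ∀ {ψ Λ' Γ} → IsInput Λ' → IsNested Γ → IsNested ([ ψ ∶ Λ' ] ∷ Γ)

iIn : ∀ {Λ} → IsInput Λ → Fml
iIn []                    = ⊤'
iIn (•∷ {φ} w)            = iIn w ∧' φ
iIn ([]∷ {ψ} w' w)        = iIn w ∧' (ψ ◇→ iIn w')

mutual
  iN : ∀ {Γ} → IsNested Γ → Fml
  iN w = ant w ⇒ con w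

  ant : ∀ {Γ} → IsNested Γ → Fml
  ant (here∘ w)             = iIn w
  ant (here[] w' w)         = iIn w
  ant (there• {φ} w)        = ant w ∧' φ
  ant (there[] {ψ} w' w)    = ant w ∧' (ψ ◇→ iIn w')

  con : ∀ {Γ} → IsNested Γ → Fml
  con (here∘ {φ} w)         = φ
  con (here[] {ψ} w' w)     = ψ □→ iN w'
  con (there• w)            = con w
  con (there[] w' w)        = con w

mutual
  data _≈ᵢ_ : Item → Item → Set where
    •refl : ∀ {φ} → (• φ) ≈ᵢ (• φ)
    ∘refl : ∀ {φ} → (∘ φ) ≈ᵢ (∘ φ)
    []cong : ∀ {ψ Δ Δ'} → Δ ≋ Δ' → [ ψ ∶ Δ ] ≈ᵢ [ ψ ∶ Δ' ]

  data _≋_ : Seq → Seq → Set where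
    []    : [] ≋ []
    _∷_   : ∀ {x y xs ys} → x ≈ᵢ y → xs ≋ ys → (x ∷ xs) ≋ (y ∷ ys)
    swap  : ∀ {x y xs} → (x ∷ y ∷ xs) ≋ (y ∷ x ∷ xs)
    trans : ∀ {xs ys zs} → xs ≋ ys → ys ≋ zs → xs ≋ zs

data Ctx : Set where
  hole  : Ctx
  _,,_  : Seq → Ctx → Ctx
  [_∶_]ᶜ : Fml → Ctx → Ctx

_⟪_⟫ : Ctx → Seq → Seq
hole        ⟪ Σ ⟫ = Σ
(Δ ,, C)    ⟪ Σ ⟫ = Δ ++ (C ⟪ Σ ⟫)
[ φ ∶ C ]ᶜ  ⟪ Σ ⟫ = [ φ ∶ C ⟪ Σ ⟫ ] ∷ []

delOut : Seq → Seq
delOut []                = []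
delOut (• φ ∷ Δ)         = • φ ∷ delOut Δ
delOut (∘ φ ∷ Δ)         = delOut Δ
delOut ([ ψ ∶ Δ' ] ∷ Δ)  = [ ψ ∶ delOut Δ' ] ∷ delOut Δ

_↓ : Ctx → Ctx
hole ↓         = hole
(Δ ,, C) ↓     = delOut Δ ,, (C ↓)
[ φ ∶ C ]ᶜ ↓   = [ φ ∶ C ↓ ]ᶜ

-- The calculus N.IntCK.  Every node of a derivation must be a nested
-- sequent (this enforces that only admissible context fillings occur).

data N⊢_ : Seq → Set where
  init : ∀ C p → IsNested (C ⟪ • atom p ∷ ∘ atom p ∷ [] ⟫)
       → N⊢ (C ⟪ • atom p ∷ ∘ atom p ∷ [] ⟫)
  ⊥•   : ∀ C → IsNested (C ⟪ • falsum ∷ [] ⟫) → N⊢ (C ⟪ • falsum ∷ [] ⟫)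
  ∧•   : ∀ C φ ψ → IsNested (C ⟪ • (φ ∧' ψ) ∷ [] ⟫)
       → N⊢ (C ⟪ • φ ∷ • ψ ∷ [] ⟫) → N⊢ (C ⟪ • (φ ∧' ψ) ∷ [] ⟫)
  ∧∘   : ∀ C φ ψ → IsNested (C ⟪ ∘ (φ ∧' ψ) ∷ [] ⟫)
       → N⊢ (C ⟪ ∘ φ ∷ [] ⟫) → N⊢ (C ⟪ ∘ ψ ∷ [] ⟫) → N⊢ (C ⟪ ∘ (φ ∧' ψ) ∷ [] ⟫)
  ∨•   : ∀ C φ ψ → IsNested (C ⟪ • (φ ∨' ψ) ∷ [] ⟫)
       → N⊢ (C ⟪ • φ ∷ [] ⟫) → N⊢ (C ⟪ • ψ ∷ [] ⟫) → N⊢ (C ⟪ • (φ ∨' ψ) ∷ [] ⟫)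
  ∨∘₁  : ∀ C φ ψ → IsNested (C ⟪ ∘ (φ ∨' ψ) ∷ [] ⟫)
       → N⊢ (C ⟪ ∘ φ ∷ [] ⟫) → N⊢ (C ⟪ ∘ (φ ∨' ψ) ∷ [] ⟫)
  ∨∘₂  : ∀ C φ ψ → IsNested (C ⟪ ∘ (φ ∨' ψ) ∷ [] ⟫)
       → N⊢ (C ⟪ ∘ ψ ∷ [] ⟫) → N⊢ (C ⟪ ∘ (φ ∨' ψ) ∷ [] ⟫)
  ⇒•   : ∀ C φ ψ → IsNested (C ⟪ • (φ ⇒ ψ) ∷ [] ⟫)
       → N⊢ ((C ↓) ⟪ • (φ ⇒ ψ) ∷ ∘ φ ∷ [] ⟫) → N⊢ (C ⟪ • ψ ∷ [] ⟫)
       → N⊢ (C ⟪ • (φ ⇒ ψ) ∷ [] ⟫)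
  ⇒∘   : ∀ C φ ψ → IsNested (C ⟪ ∘ (φ ⇒ ψ) ∷ [] ⟫)
       → N⊢ (C ⟪ • φ ∷ ∘ ψ ∷ [] ⟫) → N⊢ (C ⟪ ∘ (φ ⇒ ψ) ∷ [] ⟫)
  □•   : ∀ C φ ψ η Δ → IsNested (C ⟪ • (φ □→ ψ) ∷ [ η ∶ Δ ] ∷ [] ⟫)
       → N⊢ (• φ ∷ ∘ η ∷ []) → N⊢ (• η ∷ ∘ φ ∷ [])
       → N⊢ (C ⟪ • (φ □→ ψ) ∷ [ η ∶ • ψ ∷ Δ ] ∷ [] ⟫)
       → N⊢ (C ⟪ • (φ □→ ψ) ∷ [ η ∶ Δ ] ∷ [] ⟫)
  □∘   : ∀ C φ ψ → IsNested (C ⟪ ∘ (φ □→ ψ) ∷ [] ⟫)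
       → N⊢ (C ⟪ [ φ ∶ ∘ ψ ∷ [] ] ∷ [] ⟫) → N⊢ (C ⟪ ∘ (φ □→ ψ) ∷ [] ⟫)
  ◇•   : ∀ C φ ψ → IsNested (C ⟪ • (φ ◇→ ψ) ∷ [] ⟫)
       → N⊢ (C ⟪ [ φ ∶ • ψ ∷ [] ] ∷ [] ⟫) → N⊢ (C ⟪ • (φ ◇→ ψ) ∷ [] ⟫)
  ◇∘   : ∀ C φ ψ η Δ → IsNested (C ⟪ ∘ (φ ◇→ ψ) ∷ [ η ∶ Δ ] ∷ [] ⟫)
       → N⊢ (• φ ∷ ∘ η ∷ []) → N⊢ (• η ∷ ∘ φ ∷ [])
       → N⊢ (C ⟪ [ η ∶ ∘ ψ ∷ Δ ] ∷ [] ⟫)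
       → N⊢ (C ⟪ ∘ (φ ◇→ ψ) ∷ [ η ∶ Δ ] ∷ [] ⟫)
  exch : ∀ {Γ Γ'} → Γ ≋ Γ' → IsNested Γ' → N⊢ Γ → N⊢ Γ'

-- Read a sequent Γ as Sem Γ = Ant Γ ⇒ Suc Γ, where input formulas and output-free components
-- [ψ : Λ] are conjuncts φ resp. ψ ◇→ Ant Λ of Ant Γ, and the output formula and the component
-- [ψ : Γ′] containing it are disjuncts φ resp. ψ □→ Sem Γ′ of Suc Γ.  Unlike i(Γ), this reading
-- commutes with list concatenation; it is invariant under exchange and entails i(Γ).
--
-- Each rule is sound for its active part, and this lifts through contexts because every layer
-- Δ ,, _ or [ψ : _] acts on the semantics of an output-carrying filling by Ant Δ ⇒ _ resp. ψ □→ _,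
-- which preserve theorems and binary consequence (CN□, CC□), and on the antecedent of an
-- output-free filling by Ant Δ ∧' _ resp. ψ ◇→ _, which preserve inconsistency and disjunctions
-- (CN◇, CC◇), the two being linked by CW.  When the output lies off the path to the hole, the
-- rule is applied at the component where the path branches off the output; for ⇒•, whose left
-- premiss moves the output into the hole, the inputs around the old output are discharged by CFS.

module Submission where

open import Defs
open import Data.Bool using (Bool; true; false; _∨_)
open import Data.Bool.Properties using (∨-assoc; ∨-comm; ∨-identityʳ; ∨-zeroʳ)
open import Data.Empty using (⊥; ⊥-elim)
open import Data.List using (List; []; _∷_; _++_)
open import Data.List.Membership.Propositional using (_∈_)
open import Data.List.Relation.Unary.Any using (here; there)
open import Data.Product using (_×_; _,_; proj₂)
open import Data.Sum using (_⊎_; inj₁; inj₂)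
open import Function using (_∘_; id)
open import Relation.Binary.PropositionalEquality
  using (_≡_; refl; sym; cong; cong₂) renaming (trans to ≡-trans)

variable
  a b c d s φ ψ η : Fml
  H : List Fml
  Γ Δ X Λ Π Σ₁ Σ₂ Σ₃ : Seq
  C : Ctx

infix 2 _⊩_

data _⊩_ (H : List Fml) : Fml → Set where
  hyp : φ ∈ H → H ⊩ φ
  thm : ⊢ φ → H ⊩ φ
  app : H ⊩ φ ⇒ ψ → H ⊩ φ → H ⊩ ψ

⇒-refl : ⊢ (φ ⇒ φ)
⇒-refl {φ} = mp (mp (ipc2 {φ} {φ ⇒ φ} {φ}) ipc1) (ipc1 {φ} {φ})

lam : φ ∷ H ⊩ ψ → H ⊩ φ ⇒ ψ
lam (hyp (here refl)) = thm ⇒-refl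
lam (hyp (there x))   = app (thm ipc1) (hyp x)
lam (thm t)           = app (thm ipc1) (thm t)
lam (app f t)         = app (app (thm ipc2) (lam f)) (lam t)

closed : [] ⊩ φ → ⊢ φ
closed (hyp ())
closed (thm t)   = t
closed (app f t) = mp (closed f) (closed t)

by : ⊢ (φ ⇒ ψ) → H ⊩ φ → H ⊩ ψ
by p = app (thm p)

v0 : a ∷ H ⊩ a
v0 = hyp (here refl)

v1 : b ∷ a ∷ H ⊩ a
v1 = hyp (there (here refl))

v2 : c ∷ b ∷ a ∷ H ⊩ a
v2 = hyp (there (there (here refl)))

v3 : d ∷ c ∷ b ∷ a ∷ H ⊩ a
v3 = hyp (there (there (there (here refl))))

⊤I : H ⊩ ⊤'
⊤I = thm ⇒-refl

∧I : H ⊩ a → H ⊩ b → H ⊩ a ∧' b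
∧I t u = app (by ipc5 t) u

∧E₁ : H ⊩ a ∧' b → H ⊩ a
∧E₁ = by ipc3

∧E₂ : H ⊩ a ∧' b → H ⊩ b
∧E₂ = by ipc4

∨I₁ : H ⊩ a → H ⊩ a ∨' b
∨I₁ = by ipc6

∨I₂ : H ⊩ b → H ⊩ a ∨' b
∨I₂ = by ipc7

∨E : H ⊩ a ∨' b → a ∷ H ⊩ c → b ∷ H ⊩ c → H ⊩ c
∨E t f g = app (app (by ipc8 (lam f)) (lam g)) t

⊥E : H ⊩ falsum → H ⊩ a
⊥E = by ipc9

⇒-trans : ⊢ (a ⇒ b) → ⊢ (b ⇒ c) → ⊢ (a ⇒ c)
⇒-trans f g = closed (lam (by g (by f v0)))

mp₂ : ⊢ (a ∧' b ⇒ c) → ⊢ a → ⊢ b → ⊢ c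
mp₂ p x y = mp p (closed (∧I (thm x) (thm y)))

∧'-swap : ⊢ (a ∧' b ⇒ b ∧' a)
∧'-swap = closed (lam (∧I (∧E₂ v0) (∧E₁ v0)))

∧'-diag : ⊢ (a ⇒ a ∧' a)
∧'-diag = closed (lam (∧I v0 v0))

∧'-map-swap : ⊢ (a ⇒ c) → ⊢ (b ⇒ d) → ⊢ (a ∧' b ⇒ d ∧' c)
∧'-map-swap f g = closed (lam (∧I (by g (∧E₂ v0)) (by f (∧E₁ v0))))

infix 3 _⟺_

record _⟺_ (a b : Fml) : Set where
  constructor mk⟺
  field
    to   : ⊢ (a ⇒ b)
    from : ⊢ (b ⇒ a)

open _⟺_

⟺-refl : a ⟺ a
⟺-refl = mk⟺ ⇒-refl ⇒-refl

⟺-trans : a ⟺ b → b ⟺ c → a ⟺ c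
⟺-trans (mk⟺ f g) (mk⟺ f′ g′) = mk⟺ (⇒-trans f f′) (⇒-trans g′ g)

⟺-sym : a ⟺ b → b ⟺ a
⟺-sym (mk⟺ f g) = mk⟺ g f

⇔-intro : a ⟺ b → ⊢ (a ⇔ b)
⇔-intro (mk⟺ f g) = closed (∧I (thm f) (thm g))

⇔-elim : ⊢ (a ⇔ b) → a ⟺ b
⇔-elim p = mk⟺ (mp ipc3 p) (mp ipc4 p)

∧'-cong : a ⟺ b → c ⟺ d → a ∧' c ⟺ b ∧' d
∧'-cong (mk⟺ f g) (mk⟺ f′ g′) =
  mk⟺ (closed (lam (∧I (by f (∧E₁ v0)) (by f′ (∧E₂ v0)))))
      (closed (lam (∧I (by g (∧E₁ v0)) (by g′ (∧E₂ v0)))))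

∨'-cong : a ⟺ b → c ⟺ d → a ∨' c ⟺ b ∨' d
∨'-cong (mk⟺ f g) (mk⟺ f′ g′) =
  mk⟺ (closed (lam (∨E v0 (∨I₁ (by f v0)) (∨I₂ (by f′ v0)))))
      (closed (lam (∨E v0 (∨I₁ (by g v0)) (∨I₂ (by g′ v0)))))

⇒-congʳ : a ⟺ b → c ⇒ a ⟺ c ⇒ b
⇒-congʳ (mk⟺ f g) =
  mk⟺ (closed (lam (lam (by f (app v1 v0))))) (closed (lam (lam (by g (app v1 v0)))))

⇒-congˡ : a ⟺ b → a ⇒ c ⟺ b ⇒ c
⇒-congˡ (mk⟺ f g) =
  mk⟺ (closed (lam (lam (app v1 (by g v0))))) (closed (lam (lam (app v1 (by f v0)))))

∧'-identityˡ : ⊤' ∧' a ⟺ a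
∧'-identityˡ = mk⟺ ipc4 (closed (lam (∧I ⊤I v0)))

∨'-identityˡ : falsum ∨' a ⟺ a
∨'-identityˡ = mk⟺ (closed (lam (∨E v0 (⊥E v0) v0))) ipc7

∧'-assoc : (a ∧' b) ∧' c ⟺ a ∧' (b ∧' c)
∧'-assoc = mk⟺
  (closed (lam (∧I (∧E₁ (∧E₁ v0)) (∧I (∧E₂ (∧E₁ v0)) (∧E₂ v0)))))
  (closed (lam (∧I (∧I (∧E₁ v0) (∧E₁ (∧E₂ v0))) (∧E₂ (∧E₂ v0)))))

∨'-assoc : (a ∨' b) ∨' c ⟺ a ∨' (b ∨' c)
∨'-assoc = mk⟺
  (closed (lam (∨E v0 (∨E v0 (∨I₁ v0) (∨I₂ (∨I₁ v0))) (∨I₂ (∨I₂ v0)))))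
  (closed (lam (∨E v0 (∨I₁ (∨I₁ v0)) (∨E v0 (∨I₁ (∨I₂ v0)) (∨I₂ v0)))))

∧'-exchange : a ∧' (b ∧' c) ⟺ b ∧' (a ∧' c)
∧'-exchange = mk⟺ ex ex
  where
  ex : ⊢ (a ∧' (b ∧' c) ⇒ b ∧' (a ∧' c))
  ex = closed (lam (∧I (∧E₁ (∧E₂ v0)) (∧I (∧E₁ v0) (∧E₂ (∧E₂ v0)))))

∨'-exchange : a ∨' (b ∨' c) ⟺ b ∨' (a ∨' c)
∨'-exchange = mk⟺ ex ex
  where
  ex : ⊢ (a ∨' (b ∨' c) ⇒ b ∨' (a ∨' c))
  ex = closed (lam (∨E v0 (∨I₂ (∨I₁ v0)) (∨E v0 (∨I₁ v0) (∨I₂ (∨I₂ v0)))))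

∨'-absurdˡ : ⊢ (a ⇒ falsum) → a ∨' b ⟺ b
∨'-absurdˡ p = mk⟺ (closed (lam (∨E v0 (⊥E (by p v0)) v0))) ipc7

∨'-absurdʳ : ⊢ (b ⇒ falsum) → a ∨' b ⟺ a
∨'-absurdʳ p = mk⟺ (closed (lam (∨E v0 v0 (⊥E (by p v0))))) ipc6

curry : (a ∧' b ⇒ c) ⟺ (a ⇒ b ⇒ c)
curry = mk⟺ (closed (lam (lam (lam (app v2 (∧I v1 v0))))))
            (closed (lam (lam (app (app v1 (∧E₁ v0)) (∧E₂ v0)))))

transport₁ : ∀ {a₁ a₂ b₁ b₂} → a₁ ⟺ b₁ → a₂ ⟺ b₂ → ⊢ (b₁ ⇒ b₂) → ⊢ (a₁ ⇒ a₂)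
transport₁ e₁ e₂ p = ⇒-trans (to e₁) (⇒-trans p (from e₂))

transport₂ : ∀ {a₁ a₂ a₃ b₁ b₂ b₃} → a₁ ⟺ b₁ → a₂ ⟺ b₂ → a₃ ⟺ b₃
           → ⊢ (b₁ ∧' b₂ ⇒ b₃) → ⊢ (a₁ ∧' a₂ ⇒ a₃)
transport₂ e₁ e₂ e₃ p = transport₁ (∧'-cong e₁ e₂) e₃ p

□-congʳ : a ⟺ b → φ □→ a ⟺ φ □→ b
□-congʳ e = ⇔-elim (RC□ (⇔-intro e))

□-congˡ : a ⟺ b → a □→ φ ⟺ b □→ φ
□-congˡ e = ⇔-elim (RA□ (⇔-intro e))

◇-congʳ : a ⟺ b → φ ◇→ a ⟺ φ ◇→ b
◇-congʳ e = ⇔-elim (RC◇ (⇔-intro e))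

◇-congˡ : a ⟺ b → a ◇→ φ ⟺ b ◇→ φ
◇-congˡ e = ⇔-elim (RA◇ (⇔-intro e))

□-mono : ⊢ (a ⇒ b) → ⊢ ((φ □→ a) ⇒ (φ □→ b))
□-mono p = ⇒-trans (to (□-congʳ (mk⟺ (closed (lam (∧I v0 (by p v0)))) ipc3)))
                   (⇒-trans CM□ ipc4)

□-nec : ⊢ a → ⊢ (φ □→ a)
□-nec p = mp (□-mono (closed (lam (thm p)))) CN□

◇-mono : ⊢ (a ⇒ b) → ⊢ ((φ ◇→ a) ⇒ (φ ◇→ b))
◇-mono p = ⇒-trans (⇒-trans ipc6 CM◇)
                   (to (◇-congʳ (mk⟺ (closed (lam (∨E v0 (by p v0) v0))) ipc7)))

-- F transforms the semantics of a filling that contains the output, G the antecedent of one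
-- that does not.
record Layer (F G : Fml → Fml) : Set where
  field
    nec    : ∀ {a} → ⊢ a → ⊢ F a
    mono₂  : ∀ {a b c} → ⊢ (a ∧' b ⇒ c) → ⊢ (F a ∧' F b ⇒ F c)
    absurd : ∀ {a} → ⊢ (a ⇒ falsum) → ⊢ (G a ⇒ falsum)
    split  : ∀ {a b c} → ⊢ (c ⇒ a ∨' b) → ⊢ (G c ⇒ G a ∨' G b)
    cut    : ∀ {s a b} → ⊢ (s ∧' a ⇒ b) → ⊢ (F s ∧' G a ⇒ G b)

  mono : ∀ {a b} → ⊢ (a ⇒ b) → ⊢ (F a ⇒ F b)
  mono p = ⇒-trans ∧'-diag (mono₂ (⇒-trans ipc3 p))

id-layer : Layer id id
id-layer = record { nec = id ; mono₂ = id ; absurd = id ; split = id ; cut = id }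

_∘ˡ_ : ∀ {F G F′ G′} → Layer F G → Layer F′ G′ → Layer (F ∘ F′) (G ∘ G′)
L ∘ˡ L′ = record
  { nec    = L.nec ∘ L′.nec
  ; mono₂  = L.mono₂ ∘ L′.mono₂
  ; absurd = L.absurd ∘ L′.absurd
  ; split  = L.split ∘ L′.split
  ; cut    = L.cut ∘ L′.cut
  }
  where
  module L = Layer L
  module L′ = Layer L′

⇒-layer : ∀ d → Layer (d ⇒_) (d ∧'_)
⇒-layer d = record
  { nec    = λ p → closed (lam (thm p))
  ; mono₂  = λ p → closed (lam (lam (by p (∧I (app (∧E₁ v1) v0) (app (∧E₂ v1) v0)))))
  ; absurd = λ p → ⇒-trans ipc4 p
  ; split  = λ p → closed (lam (∨E (by p (∧E₂ v0)) (∨I₁ (∧I (∧E₁ v1) v0)) (∨I₂ (∧I (∧E₁ v1) v0))))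
  ; cut    = λ p → closed (lam (∧I (∧E₁ (∧E₂ v0))
                     (by p (∧I (app (∧E₁ v0) (∧E₁ (∧E₂ v0))) (∧E₂ (∧E₂ v0))))))
  }

□◇-layer : ∀ φ → Layer (φ □→_) (φ ◇→_)
□◇-layer φ = record
  { nec    = □-nec
  ; mono₂  = λ p → ⇒-trans CC□ (□-mono p)
  ; absurd = λ p → closed (lam (by CN◇ (by (◇-mono p) v0)))
  ; split  = λ p → ⇒-trans (◇-mono p) CC◇
  ; cut    = λ p → ⇒-trans (⇒-trans ∧'-swap CW) (◇-mono (⇒-trans ∧'-swap p))
  }

mutual
  hasOutᵢ : Item → Bool
  hasOutᵢ (• φ)     = false
  hasOutᵢ (∘ φ)     = true
  hasOutᵢ [ ψ ∶ Δ ] = hasOut Δ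

  hasOut : Seq → Bool
  hasOut []      = false
  hasOut (x ∷ Δ) = hasOutᵢ x ∨ hasOut Δ

hasOutᶜ : Ctx → Bool
hasOutᶜ hole       = false
hasOutᶜ (Δ ,, C)   = hasOut Δ ∨ hasOutᶜ C
hasOutᶜ [ φ ∶ C ]ᶜ = hasOutᶜ C

∨-conical : ∀ x y → x ∨ y ≡ false → x ≡ false × y ≡ false
∨-conical false y e = refl , e

∨-exchange : ∀ x y z → x ∨ (y ∨ z) ≡ y ∨ (x ∨ z)
∨-exchange x y z =
  ≡-trans (sym (∨-assoc x y z)) (≡-trans (cong (_∨ z) (∨-comm x y)) (∨-assoc y x z))

hasOut-++ : ∀ Δ X → hasOut (Δ ++ X) ≡ hasOut Δ ∨ hasOut X
hasOut-++ []      X = refl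
hasOut-++ (x ∷ Δ) X =
  ≡-trans (cong (hasOutᵢ x ∨_) (hasOut-++ Δ X)) (sym (∨-assoc (hasOutᵢ x) (hasOut Δ) (hasOut X)))

hasOut-fill : ∀ C Σ → hasOut (C ⟪ Σ ⟫) ≡ hasOutᶜ C ∨ hasOut Σ
hasOut-fill hole       Σ = refl
hasOut-fill (Δ ,, C)   Σ = ≡-trans (hasOut-++ Δ (C ⟪ Σ ⟫))
  (≡-trans (cong (hasOut Δ ∨_) (hasOut-fill C Σ)) (sym (∨-assoc (hasOut Δ) (hasOutᶜ C) (hasOut Σ))))
hasOut-fill [ φ ∶ C ]ᶜ Σ = ≡-trans (∨-identityʳ (hasOut (C ⟪ Σ ⟫))) (hasOut-fill C Σ)

hasOut-fill-true : ∀ C → hasOut Σ₁ ≡ true → hasOut (C ⟪ Σ₁ ⟫) ≡ true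
hasOut-fill-true {Σ₁} C e =
  ≡-trans (hasOut-fill C Σ₁) (≡-trans (cong (hasOutᶜ C ∨_) e) (∨-zeroʳ (hasOutᶜ C)))

hasOut-fill-false : ∀ C → hasOut Σ₁ ≡ false → hasOut (C ⟪ Σ₁ ⟫) ≡ hasOutᶜ C
hasOut-fill-false {Σ₁} C e =
  ≡-trans (hasOut-fill C Σ₁) (≡-trans (cong (hasOutᶜ C ∨_) e) (∨-identityʳ (hasOutᶜ C)))

hasOut-input : IsInput Λ → hasOut Λ ≡ false
hasOut-input []                                 = refl
hasOut-input (•∷ w)                             = hasOut-input w
hasOut-input ([]∷ w′ w) rewrite hasOut-input w′ = hasOut-input w

hasOut-nested : IsNested Γ → hasOut Γ ≡ true
hasOut-nested (here∘ w)                            = refl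
hasOut-nested (here[] w′ w) rewrite hasOut-nested w′ = refl
hasOut-nested (there• w)                           = hasOut-nested w
hasOut-nested (there[] w′ w) rewrite hasOut-input w′ = hasOut-nested w

nested-output-free : IsNested Γ → hasOut Γ ≡ false → ⊥
nested-output-free w e with ≡-trans (sym (hasOut-nested w)) e
... | ()

input-with-output : IsInput Λ → hasOut Λ ≡ true → ⊥
input-with-output w e with ≡-trans (sym e) (hasOut-input w)
... | ()

split-input : ∀ Δ → IsInput (Δ ++ X) → IsInput Δ × IsInput X
split-input []               w = [] , w
split-input (• φ ∷ Δ)        (•∷ w) with split-input Δ w
... | wΔ , wX = •∷ wΔ , wX
split-input ([ ψ ∶ Δ′ ] ∷ Δ) ([]∷ w′ w) with split-input Δ w
... | wΔ , wX = []∷ w′ wΔ , wX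

split-nested : ∀ Δ → IsNested (Δ ++ X) → IsNested Δ × IsInput X ⊎ IsInput Δ × IsNested X
split-nested []               w = inj₂ ([] , w)
split-nested (∘ φ ∷ Δ)        (here∘ w) with split-input Δ w
... | wΔ , wX = inj₁ (here∘ wΔ , wX)
split-nested ([ ψ ∶ Δ′ ] ∷ Δ) (here[] w′ w) with split-input Δ w
... | wΔ , wX = inj₁ (here[] w′ wΔ , wX)
split-nested (• φ ∷ Δ)        (there• w) with split-nested Δ w
... | inj₁ (wΔ , wX) = inj₁ (there• wΔ , wX)
... | inj₂ (wΔ , wX) = inj₂ (•∷ wΔ , wX)
split-nested ([ ψ ∶ Δ′ ] ∷ Δ) (there[] w′ w) with split-nested Δ w
... | inj₁ (wΔ , wX) = inj₁ (there[] w′ wΔ , wX)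
... | inj₂ (wΔ , wX) = inj₂ ([]∷ w′ wΔ , wX)

nested-hole : ∀ C → IsNested (C ⟪ Σ₁ ⟫) → hasOut Σ₁ ≡ true → IsNested Σ₁ × hasOutᶜ C ≡ false
nested-hole hole w e = w , refl
nested-hole (Δ ,, C) w e with split-nested Δ w
... | inj₁ (_ , wC) = ⊥-elim (input-with-output wC (hasOut-fill-true C e))
... | inj₂ (wΔ , wC) rewrite hasOut-input wΔ = nested-hole C wC e
nested-hole [ φ ∶ C ]ᶜ (here[] w []) e = nested-hole C w e

hole-free : ∀ C → IsNested (C ⟪ Σ₁ ⟫) → hasOut Σ₁ ≡ true → hasOutᶜ C ≡ false
hole-free C w e = proj₂ (nested-hole C w e)

delOut-input : IsInput Λ → delOut Λ ≡ Λ
delOut-input []                                          = refl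
delOut-input (•∷ w)     rewrite delOut-input w           = refl
delOut-input ([]∷ w′ w) rewrite delOut-input w′ | delOut-input w = refl

delOut-isInput : ∀ Γ → IsInput (delOut Γ)
delOut-isInput []               = []
delOut-isInput (• φ ∷ Γ)        = •∷ (delOut-isInput Γ)
delOut-isInput (∘ φ ∷ Γ)        = delOut-isInput Γ
delOut-isInput ([ ψ ∶ Δ ] ∷ Γ) = []∷ (delOut-isInput Δ) (delOut-isInput Γ)

↓-input : ∀ C → IsInput (C ⟪ Σ₁ ⟫) → C ↓ ≡ C
↓-input hole       w = refl
↓-input (Δ ,, C)   w with split-input Δ w
... | wΔ , wC rewrite delOut-input wΔ | ↓-input C wC = refl
↓-input [ φ ∶ C ]ᶜ ([]∷ w []) rewrite ↓-input C w = refl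

componentAnt : Bool → Fml → Fml → Fml
componentAnt true  ψ a = ⊤'
componentAnt false ψ a = ψ ◇→ a

componentSuc : Bool → Fml → Fml → Fml
componentSuc true  ψ s = ψ □→ s
componentSuc false ψ s = falsum

mutual
  Antᵢ : Item → Fml
  Antᵢ (• φ)     = φ
  Antᵢ (∘ φ)     = ⊤'
  Antᵢ [ ψ ∶ Δ ] = componentAnt (hasOut Δ) ψ (Ant Δ)

  Ant : Seq → Fml
  Ant []      = ⊤'
  Ant (x ∷ Δ) = Antᵢ x ∧' Ant Δ

  Sucᵢ : Item → Fml
  Sucᵢ (• φ)     = falsum
  Sucᵢ (∘ φ)     = φ
  Sucᵢ [ ψ ∶ Δ ] = componentSuc (hasOut Δ) ψ (Sem Δ)

  Suc : Seq → Fml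
  Suc []      = falsum
  Suc (x ∷ Δ) = Sucᵢ x ∨' Suc Δ

  Sem : Seq → Fml
  Sem Δ = Ant Δ ⇒ Suc Δ

Ant-++ : ∀ Δ X → Ant (Δ ++ X) ⟺ Ant Δ ∧' Ant X
Ant-++ []      X = ⟺-sym ∧'-identityˡ
Ant-++ (x ∷ Δ) X = ⟺-trans (∧'-cong ⟺-refl (Ant-++ Δ X)) (⟺-sym ∧'-assoc)

Suc-++ : ∀ Δ X → Suc (Δ ++ X) ⟺ Suc Δ ∨' Suc X
Suc-++ []      X = ⟺-sym ∨'-identityˡ
Suc-++ (x ∷ Δ) X = ⟺-trans (∨'-cong ⟺-refl (Suc-++ Δ X)) (⟺-sym ∨'-assoc)

Sem-++ : ∀ Δ X → Sem (Δ ++ X) ⟺ (Ant Δ ∧' Ant X ⇒ Suc Δ ∨' Suc X)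
Sem-++ Δ X = ⟺-trans (⇒-congˡ (Ant-++ Δ X)) (⇒-congʳ (Suc-++ Δ X))

mutual
  Sucᵢ-absurd : ∀ x → hasOutᵢ x ≡ false → ⊢ (Sucᵢ x ⇒ falsum)
  Sucᵢ-absurd (• φ)     _ = ⇒-refl
  Sucᵢ-absurd [ ψ ∶ Δ ] e rewrite e = ⇒-refl

  Suc-absurd : ∀ Δ → hasOut Δ ≡ false → ⊢ (Suc Δ ⇒ falsum)
  Suc-absurd []      _ = ⇒-refl
  Suc-absurd (x ∷ Δ) e with ∨-conical (hasOutᵢ x) (hasOut Δ) e
  ... | ex , eΔ = closed (lam (∨E v0 (by (Sucᵢ-absurd x ex) v0) (by (Suc-absurd Δ eΔ) v0)))

Sem-inputPrefix : ∀ Δ X → hasOut Δ ≡ false → Sem (Δ ++ X) ⟺ (Ant Δ ⇒ Sem X)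
Sem-inputPrefix Δ X e =
  ⟺-trans (Sem-++ Δ X) (⟺-trans (⇒-congʳ (∨'-absurdˡ (Suc-absurd Δ e))) curry)

Sem-inputSuffix : ∀ Δ X → hasOut X ≡ false → Sem (Δ ++ X) ⟺ (Ant Δ ∧' Ant X ⇒ Suc Δ)
Sem-inputSuffix Δ X e = ⟺-trans (Sem-++ Δ X) (⇒-congʳ (∨'-absurdʳ (Suc-absurd X e)))

Sem-□component : ∀ φ X → hasOut X ≡ true → Sem ([ φ ∶ X ] ∷ []) ⟺ (φ □→ Sem X)
Sem-□component φ X e rewrite e =
  mk⟺ (closed (lam (∨E (app v0 (∧I ⊤I ⊤I)) v0 (⊥E v0)))) (closed (lam (lam (∨I₁ v1))))

Ant-◇component : ∀ φ X → hasOut X ≡ false → Ant ([ φ ∶ X ] ∷ []) ⟺ (φ ◇→ Ant X)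
Ant-◇component φ X e rewrite e = mk⟺ ipc3 (closed (lam (∧I v0 ⊤I)))

⟦_⟧ˢ : Ctx → Fml → Fml
⟦ hole       ⟧ˢ a = a
⟦ Δ ,, C     ⟧ˢ a = Ant Δ ⇒ ⟦ C ⟧ˢ a
⟦ [ φ ∶ C ]ᶜ ⟧ˢ a = φ □→ ⟦ C ⟧ˢ a

⟦_⟧ᵃ : Ctx → Fml → Fml
⟦ hole       ⟧ᵃ a = a
⟦ Δ ,, C     ⟧ᵃ a = Ant Δ ∧' ⟦ C ⟧ᵃ a
⟦ [ φ ∶ C ]ᶜ ⟧ᵃ a = φ ◇→ ⟦ C ⟧ᵃ a

ctx-layer : ∀ C → Layer ⟦ C ⟧ˢ ⟦ C ⟧ᵃ
ctx-layer hole       = id-layer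
ctx-layer (Δ ,, C)   = ⇒-layer (Ant Δ) ∘ˡ ctx-layer C
ctx-layer [ φ ∶ C ]ᶜ = □◇-layer φ ∘ˡ ctx-layer C

Sem-fill : ∀ C → hasOutᶜ C ≡ false → hasOut Σ₁ ≡ true → Sem (C ⟪ Σ₁ ⟫) ⟺ ⟦ C ⟧ˢ (Sem Σ₁)
Sem-fill hole _ _ = ⟺-refl
Sem-fill {Σ₁} (Δ ,, C) oc e with ∨-conical (hasOut Δ) (hasOutᶜ C) oc
... | oΔ , oC = ⟺-trans (Sem-inputPrefix Δ (C ⟪ Σ₁ ⟫) oΔ) (⇒-congʳ (Sem-fill C oC e))
Sem-fill {Σ₁} [ φ ∶ C ]ᶜ oc e =
  ⟺-trans (Sem-□component φ (C ⟪ Σ₁ ⟫) (hasOut-fill-true C e)) (□-congʳ (Sem-fill C oc e))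

Ant-fill : ∀ C → hasOutᶜ C ≡ false → hasOut Σ₁ ≡ false → Ant (C ⟪ Σ₁ ⟫) ⟺ ⟦ C ⟧ᵃ (Ant Σ₁)
Ant-fill hole _ _ = ⟺-refl
Ant-fill {Σ₁} (Δ ,, C) oc e with ∨-conical (hasOut Δ) (hasOutᶜ C) oc
... | _ , oC = ⟺-trans (Ant-++ Δ (C ⟪ Σ₁ ⟫)) (∧'-cong ⟺-refl (Ant-fill C oC e))
Ant-fill {Σ₁} [ φ ∶ C ]ᶜ oc e =
  ⟺-trans (Ant-◇component φ (C ⟪ Σ₁ ⟫) (≡-trans (hasOut-fill-false C e) oc))
          (◇-congʳ (Ant-fill C oc e))

fillᵒ-nec : ∀ C → hasOutᶜ C ≡ false → hasOut Σ₁ ≡ true → ⊢ Sem Σ₁ → ⊢ Sem (C ⟪ Σ₁ ⟫)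
fillᵒ-nec C oc e p = mp (from (Sem-fill C oc e)) (Layer.nec (ctx-layer C) p)

fillᵒ-mono : ∀ C → hasOutᶜ C ≡ false → hasOut Σ₁ ≡ true → hasOut Σ₂ ≡ true
           → ⊢ (Sem Σ₁ ⇒ Sem Σ₂) → ⊢ (Sem (C ⟪ Σ₁ ⟫) ⇒ Sem (C ⟪ Σ₂ ⟫))
fillᵒ-mono C oc e₁ e₂ p =
  transport₁ (Sem-fill C oc e₁) (Sem-fill C oc e₂) (Layer.mono (ctx-layer C) p)

fillᵒ-mono₂ : ∀ C → hasOutᶜ C ≡ false
            → hasOut Σ₁ ≡ true → hasOut Σ₂ ≡ true → hasOut Σ₃ ≡ true
            → ⊢ (Sem Σ₁ ∧' Sem Σ₂ ⇒ Sem Σ₃)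
            → ⊢ (Sem (C ⟪ Σ₁ ⟫) ∧' Sem (C ⟪ Σ₂ ⟫) ⇒ Sem (C ⟪ Σ₃ ⟫))
fillᵒ-mono₂ C oc e₁ e₂ e₃ p =
  transport₂ (Sem-fill C oc e₁) (Sem-fill C oc e₂) (Sem-fill C oc e₃) (Layer.mono₂ (ctx-layer C) p)

discharge-∧ : ⊢ ((a ⇒ c ⇒ s) ⇒ c ⇒ s)
            → ⊢ ((b ∧' a ⇒ b ∧' c ⇒ falsum ∨' s) ⇒ b ∧' c ⇒ falsum ∨' s)
discharge-∧ p = closed (lam (lam (∨I₂ (app (by p
  (lam (lam (∨E (app (app v3 (∧I (∧E₁ v2) v1)) (∧I (∧E₁ v2) v0)) (⊥E v0) v0))))
  (∧E₂ v0)))))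

-- For the output component [ψ : Γ′], CFS reduces ψ □→ (Ant (delOut Γ′) ⇒ Sem Γ′) to deriving
-- ψ □→ Sem Γ′ from ψ ◇→ Ant (delOut Γ′), which the hypothesis provides.
Sem-discharge : IsNested Γ → ⊢ ((Ant (delOut Γ) ⇒ Sem Γ) ⇒ Sem Γ)
Sem-discharge (here∘ w) rewrite delOut-input w = closed (lam (lam (app (app v1 (∧E₂ v0)) v0)))
Sem-discharge (here[] {Γ' = Γ′} {Λ = Λ} w′ w)
  rewrite delOut-input w | hasOut-nested w′ | hasOut-input (delOut-isInput Γ′) =
  closed (lam (lam (∨I₁ (by (□-mono (Sem-discharge w′)) (by CFS
    (lam (∨E (app (app v2 (∧I v0 (∧E₂ v1))) v1) v0
              (⊥E (by (Suc-absurd Λ (hasOut-input w)) v0)))))))))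
Sem-discharge (there• w) = discharge-∧ (Sem-discharge w)
Sem-discharge (there[] w′ w) rewrite delOut-input w′ | hasOut-input w′ =
  discharge-∧ (Sem-discharge w)

-- C ⟪ Σ ⟫ for output-free Σ: the output lies in core, next to inner ⟪ Σ ⟫, all inside outer.
record Decomposition (C : Ctx) : Set where
  field
    outer inner    : Ctx
    core           : Seq
    core-nested    : IsNested core
    Sem-fill-input : ∀ {Σ} → hasOut Σ ≡ false
                   → Sem (C ⟪ Σ ⟫) ⟺ ⟦ outer ⟧ˢ (Ant core ∧' ⟦ inner ⟧ᵃ (Ant Σ) ⇒ Suc core)
    Sem-fill↓      : ∀ {Π} → hasOut Π ≡ true
                   → Sem ((C ↓) ⟪ Π ⟫) ⟺ ⟦ outer ⟧ˢ (Ant (delOut core) ⇒ ⟦ inner ⟧ˢ (Sem Π))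

open Decomposition

core-decomposition : IsNested Δ → hasOutᶜ C ≡ false → C ↓ ≡ C → Decomposition (Δ ,, C)
core-decomposition {Δ} {C} wΔ oC C↓≡C = record
  { outer          = hole
  ; inner          = C
  ; core           = Δ
  ; core-nested    = wΔ
  ; Sem-fill-input = λ {Σ} e → ⟺-trans
      (Sem-inputSuffix Δ (C ⟪ Σ ⟫) (≡-trans (hasOut-fill-false C e) oC))
      (⇒-congˡ (∧'-cong ⟺-refl (Ant-fill C oC e)))
  ; Sem-fill↓      = fill↓
  }
  where
  fill↓ : hasOut Π ≡ true → Sem (delOut Δ ++ (C ↓) ⟪ Π ⟫) ⟺ (Ant (delOut Δ) ⇒ ⟦ C ⟧ˢ (Sem Π))
  fill↓ {Π} eΠ rewrite C↓≡C = ⟺-trans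
    (Sem-inputPrefix (delOut Δ) (C ⟪ Π ⟫) (hasOut-input (delOut-isInput Δ)))
    (⇒-congʳ (Sem-fill C oC eΠ))

prefix-decomposition : IsInput Δ → Decomposition C → Decomposition (Δ ,, C)
prefix-decomposition {Δ} {C} wΔ D = record
  { outer          = Δ ,, outer D
  ; inner          = inner D
  ; core           = core D
  ; core-nested    = core-nested D
  ; Sem-fill-input = λ {Σ} e → ⟺-trans
      (Sem-inputPrefix Δ (C ⟪ Σ ⟫) (hasOut-input wΔ)) (⇒-congʳ (Sem-fill-input D e))
  ; Sem-fill↓      = fill↓
  }
  where
  fill↓ : hasOut Π ≡ true → Sem (delOut Δ ++ (C ↓) ⟪ Π ⟫)
        ⟺ ⟦ Δ ,, outer D ⟧ˢ (Ant (delOut (core D)) ⇒ ⟦ inner D ⟧ˢ (Sem Π))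
  fill↓ {Π} eΠ rewrite delOut-input wΔ = ⟺-trans
    (Sem-inputPrefix Δ ((C ↓) ⟪ Π ⟫) (hasOut-input wΔ)) (⇒-congʳ (Sem-fill↓ D eΠ))

component-decomposition : ∀ φ → hasOutᶜ C ≡ true → Decomposition C → Decomposition [ φ ∶ C ]ᶜ
component-decomposition {C} φ oC D = record
  { outer          = [ φ ∶ outer D ]ᶜ
  ; inner          = inner D
  ; core           = core D
  ; core-nested    = core-nested D
  ; Sem-fill-input = λ {Σ} e → ⟺-trans
      (Sem-□component φ (C ⟪ Σ ⟫) (≡-trans (hasOut-fill-false C e) oC))
      (□-congʳ (Sem-fill-input D e))
  ; Sem-fill↓      = λ {Π} eΠ → ⟺-trans
      (Sem-□component φ ((C ↓) ⟪ Π ⟫) (hasOut-fill-true (C ↓) eΠ))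
      (□-congʳ (Sem-fill↓ D eΠ))
  }

decompose : ∀ C → IsNested (C ⟪ Σ₁ ⟫) → hasOut Σ₁ ≡ false → Decomposition C
decompose hole w e = ⊥-elim (nested-output-free w e)
decompose (Δ ,, C) w e with split-nested Δ w
... | inj₁ (wΔ , wC) =
  core-decomposition wΔ (≡-trans (sym (hasOut-fill-false C e)) (hasOut-input wC)) (↓-input C wC)
... | inj₂ (wΔ , wC) = prefix-decomposition wΔ (decompose C wC e)
decompose [ φ ∶ C ]ᶜ (here[] w []) e =
  component-decomposition φ (≡-trans (sym (hasOut-fill-false C e)) (hasOut-nested w))
    (decompose C w e)

antecedent-split : ⊢ (c ⇒ a ∨' b) → ⊢ ((d ∧' a ⇒ s) ∧' (d ∧' b ⇒ s) ⇒ d ∧' c ⇒ s)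
antecedent-split p = closed (lam (lam
  (∨E (by p (∧E₂ v0)) (app (∧E₁ v2) (∧I (∧E₁ v1) v0)) (app (∧E₂ v2) (∧I (∧E₁ v1) v0)))))

antecedent-cut : IsNested Γ → ⊢ (s ∧' c ⇒ b)
  → ⊢ ((Ant (delOut Γ) ⇒ s) ∧' (Ant Γ ∧' b ⇒ Suc Γ) ⇒ Ant Γ ∧' c ⇒ Suc Γ)
antecedent-cut w p = closed (lam (lam (app (by (Sem-discharge w)
  (lam (lam (app (∧E₂ v3) (∧I v0 (by p (∧I (app (∧E₁ v3) v1) (∧E₂ v2))))))))
  (∧E₁ v0))))

fillⁱ-absurd : ∀ C → IsNested (C ⟪ Σ₁ ⟫) → hasOut Σ₁ ≡ false
             → ⊢ (Ant Σ₁ ⇒ falsum) → ⊢ Sem (C ⟪ Σ₁ ⟫)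
fillⁱ-absurd C w e p =
  mp (from (Sem-fill-input D e)) (Outer.nec (closed (lam (⊥E (by (Inner.absurd p) (∧E₂ v0))))))
  where
  D = decompose C w e
  module Outer = Layer (ctx-layer (outer D))
  module Inner = Layer (ctx-layer (inner D))

fillⁱ-mono₂ : ∀ C → IsNested (C ⟪ Σ₃ ⟫)
            → hasOut Σ₁ ≡ false → hasOut Σ₂ ≡ false → hasOut Σ₃ ≡ false
            → ⊢ (Ant Σ₃ ⇒ Ant Σ₁ ∨' Ant Σ₂)
            → ⊢ (Sem (C ⟪ Σ₁ ⟫) ∧' Sem (C ⟪ Σ₂ ⟫) ⇒ Sem (C ⟪ Σ₃ ⟫))
fillⁱ-mono₂ C w e₁ e₂ e₃ p =
  transport₂ (Sem-fill-input D e₁) (Sem-fill-input D e₂) (Sem-fill-input D e₃)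
    (Outer.mono₂ (antecedent-split (Inner.split p)))
  where
  D = decompose C w e₃
  module Outer = Layer (ctx-layer (outer D))
  module Inner = Layer (ctx-layer (inner D))

fillⁱ-mono : ∀ C → IsNested (C ⟪ Σ₂ ⟫) → hasOut Σ₁ ≡ false → hasOut Σ₂ ≡ false
           → ⊢ (Ant Σ₂ ⇒ Ant Σ₁) → ⊢ (Sem (C ⟪ Σ₁ ⟫) ⇒ Sem (C ⟪ Σ₂ ⟫))
fillⁱ-mono C w e₁ e₂ p = ⇒-trans ∧'-diag (fillⁱ-mono₂ C w e₁ e₁ e₂ (⇒-trans p ipc6))

fillⁱ-cut : ∀ C → IsNested (C ⟪ Σ₃ ⟫)
          → hasOut Π ≡ true → hasOut Σ₂ ≡ false → hasOut Σ₃ ≡ false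
          → ⊢ (Sem Π ∧' Ant Σ₃ ⇒ Ant Σ₂)
          → ⊢ (Sem ((C ↓) ⟪ Π ⟫) ∧' Sem (C ⟪ Σ₂ ⟫) ⇒ Sem (C ⟪ Σ₃ ⟫))
fillⁱ-cut C w eΠ e₂ e₃ p =
  transport₂ (Sem-fill↓ D eΠ) (Sem-fill-input D e₂) (Sem-fill-input D e₃)
    (Outer.mono₂ (antecedent-cut (core-nested D) (Inner.cut p)))
  where
  D = decompose C w e₃
  module Outer = Layer (ctx-layer (outer D))
  module Inner = Layer (ctx-layer (inner D))

Sem-output : Sem (∘ φ ∷ []) ⟺ φ
Sem-output = mk⟺ (closed (lam (∨E (app v0 (∧I ⊤I ⊤I)) v0 (⊥E v0)))) (closed (lam (lam (∨I₁ v1))))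

Sem-input-output : Sem (• φ ∷ ∘ ψ ∷ []) ⟺ (φ ⇒ ψ)
Sem-input-output =
  mk⟺ (closed (lam (lam (∨E (app v1 (∧I v0 (∧I ⊤I ⊤I))) (⊥E v0) (∨E v0 v0 (⊥E v0))))))
      (closed (lam (lam (∨I₂ (∨I₁ (app v1 (∧E₁ v0)))))))

Ant-input : Ant (• φ ∷ []) ⟺ φ
Ant-input = mk⟺ ipc3 (closed (lam (∧I v0 ⊤I)))

interderivable : ⊢ Sem (• φ ∷ ∘ η ∷ []) → ⊢ Sem (• η ∷ ∘ φ ∷ []) → φ ⟺ η
interderivable p q = mk⟺ (mp (to Sem-input-output) p) (mp (to Sem-input-output) q)

∧•-local : ⊢ (Ant (• (φ ∧' ψ) ∷ []) ⇒ Ant (• φ ∷ • ψ ∷ []))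
∧•-local = closed (lam (∧I (∧E₁ (∧E₁ v0)) (∧I (∧E₂ (∧E₁ v0)) ⊤I)))

∧∘-local : ⊢ (Sem (∘ φ ∷ []) ∧' Sem (∘ ψ ∷ []) ⇒ Sem (∘ (φ ∧' ψ) ∷ []))
∧∘-local = transport₂ Sem-output Sem-output Sem-output ⇒-refl

∨•-local : ⊢ (Ant (• (φ ∨' ψ) ∷ []) ⇒ Ant (• φ ∷ []) ∨' Ant (• ψ ∷ []))
∨•-local = transport₁ Ant-input (∨'-cong Ant-input Ant-input) ⇒-refl

∨∘₁-local : ⊢ (Sem (∘ φ ∷ []) ⇒ Sem (∘ (φ ∨' ψ) ∷ []))
∨∘₁-local = transport₁ Sem-output Sem-output ipc6

∨∘₂-local : ⊢ (Sem (∘ ψ ∷ []) ⇒ Sem (∘ (φ ∨' ψ) ∷ []))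
∨∘₂-local = transport₁ Sem-output Sem-output ipc7

⇒•-local : ⊢ (Sem (• (φ ⇒ ψ) ∷ ∘ φ ∷ []) ∧' Ant (• (φ ⇒ ψ) ∷ []) ⇒ Ant (• ψ ∷ []))
⇒•-local = transport₁ (∧'-cong Sem-input-output Ant-input) Ant-input
  (closed (lam (app (∧E₂ v0) (app (∧E₁ v0) (∧E₂ v0)))))

⇒∘-local : ⊢ (Sem (• φ ∷ ∘ ψ ∷ []) ⇒ Sem (∘ (φ ⇒ ψ) ∷ []))
⇒∘-local = transport₁ Sem-input-output Sem-output ⇒-refl

□•-localⁱ : φ ⟺ η → hasOut Δ ≡ false
  → ⊢ (Ant (• (φ □→ ψ) ∷ [ η ∶ Δ ] ∷ []) ⇒ Ant (• (φ □→ ψ) ∷ [ η ∶ • ψ ∷ Δ ] ∷ []))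
□•-localⁱ e eo rewrite eo = closed (lam (∧I (∧E₁ v0) (∧I
  (by (◇-mono ∧'-swap) (by CW (∧I (∧E₁ (∧E₂ v0)) (by (to (□-congˡ e)) (∧E₁ v0))))) ⊤I)))

□•-localᵒ : φ ⟺ η → hasOut Δ ≡ true
  → ⊢ (Sem (• (φ □→ ψ) ∷ [ η ∶ • ψ ∷ Δ ] ∷ []) ⇒ Sem (• (φ □→ ψ) ∷ [ η ∶ Δ ] ∷ []))
□•-localᵒ {η = η} {Δ = Δ} {ψ = ψ} e eo rewrite eo = closed (lam (lam (∨E (app v1 v0) (⊥E v0)
  (∨E v0 (∨I₂ (∨I₁ (by combine (∧I (by (to (□-congˡ e)) (∧E₁ v2)) v0)))) (⊥E v0)))))
  where
  combine : ⊢ ((η □→ ψ) ∧' (η □→ Sem (• ψ ∷ Δ)) ⇒ η □→ Sem Δ)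
  combine = Layer.mono₂ (□◇-layer η) (closed (lam (lam
    (∨E (app (∧E₂ v1) (∧I (∧E₁ v1) v0)) (⊥E v0) v0))))

□∘-local : ⊢ (Sem ([ φ ∶ ∘ ψ ∷ [] ] ∷ []) ⇒ Sem (∘ (φ □→ ψ) ∷ []))
□∘-local {φ} {ψ} =
  transport₁ (⟺-trans (Sem-□component φ (∘ ψ ∷ []) refl) (□-congʳ Sem-output)) Sem-output ⇒-refl

◇•-local : ⊢ (Ant (• (φ ◇→ ψ) ∷ []) ⇒ Ant ([ φ ∶ • ψ ∷ [] ] ∷ []))
◇•-local {φ} {ψ} =
  transport₁ Ant-input (⟺-trans (Ant-◇component φ (• ψ ∷ []) refl) (◇-congʳ Ant-input)) ⇒-refl

◇∘-local : φ ⟺ η → hasOut Δ ≡ false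
  → ⊢ (Sem ([ η ∶ ∘ ψ ∷ Δ ] ∷ []) ⇒ Sem (∘ (φ ◇→ ψ) ∷ [ η ∶ Δ ] ∷ []))
◇∘-local {η = η} {Δ = Δ} {ψ = ψ} e eo rewrite eo = closed (lam (lam (∨I₁ (by (from (◇-congˡ e))
  (by (Layer.cut (□◇-layer η) out-from-Sem)
      (∧I (by (to (Sem-□component η (∘ ψ ∷ Δ) refl)) v1) (∧E₁ (∧E₂ v0))))))))
  where
  out-from-Sem : ⊢ (Sem (∘ ψ ∷ Δ) ∧' Ant Δ ⇒ ψ)
  out-from-Sem = closed (lam (∨E (app (∧E₁ v0) (∧I ⊤I (∧E₂ v0))) v0 (⊥E (by (Suc-absurd Δ eo) v0))))

Sem-cong : Ant Δ ⟺ Ant X → Suc Δ ⟺ Suc X → Sem Δ ⟺ Sem X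
Sem-cong eA eS = ⟺-trans (⇒-congˡ eA) (⇒-congʳ eS)

componentAnt-cong : ∀ o ψ → a ⟺ b → componentAnt o ψ a ⟺ componentAnt o ψ b
componentAnt-cong true  ψ e = ⟺-refl
componentAnt-cong false ψ e = ◇-congʳ e

componentSuc-cong : ∀ o ψ → a ⟺ b → componentSuc o ψ a ⟺ componentSuc o ψ b
componentSuc-cong true  ψ e = □-congʳ e
componentSuc-cong false ψ e = ⟺-refl

mutual
  ≈ᵢ-Sem : ∀ {x y} → x ≈ᵢ y → hasOutᵢ x ≡ hasOutᵢ y × Antᵢ x ⟺ Antᵢ y × Sucᵢ x ⟺ Sucᵢ y
  ≈ᵢ-Sem •refl = refl , ⟺-refl , ⟺-refl
  ≈ᵢ-Sem ∘refl = refl , ⟺-refl , ⟺-refl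
  ≈ᵢ-Sem ([]cong {ψ} {Δ} {Δ′} d) with ≋-Sem d
  ... | eo , eA , eS rewrite eo =
    refl , componentAnt-cong (hasOut Δ′) ψ eA , componentSuc-cong (hasOut Δ′) ψ (Sem-cong eA eS)

  ≋-Sem : Δ ≋ X → hasOut Δ ≡ hasOut X × Ant Δ ⟺ Ant X × Suc Δ ⟺ Suc X
  ≋-Sem [] = refl , ⟺-refl , ⟺-refl
  ≋-Sem (e ∷ d) with ≈ᵢ-Sem e | ≋-Sem d
  ... | o₁ , eA₁ , eS₁ | o₂ , eA₂ , eS₂ = cong₂ _∨_ o₁ o₂ , ∧'-cong eA₁ eA₂ , ∨'-cong eS₁ eS₂
  ≋-Sem (swap {x} {y} {Δ}) =
    ∨-exchange (hasOutᵢ x) (hasOutᵢ y) (hasOut Δ) , ∧'-exchange , ∨'-exchange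
  ≋-Sem (trans d₁ d₂) with ≋-Sem d₁ | ≋-Sem d₂
  ... | o₁ , eA₁ , eS₁ | o₂ , eA₂ , eS₂ = ≡-trans o₁ o₂ , ⟺-trans eA₁ eA₂ , ⟺-trans eS₁ eS₂

sound : N⊢ Γ → ⊢ Sem Γ
sound (init C p w)           =
  fillᵒ-nec C (hole-free C w refl) refl (mp (from Sem-input-output) ⇒-refl)
sound (⊥• C w)               = fillⁱ-absurd C w refl ipc3
sound (∧• C φ ψ w d)         = mp (fillⁱ-mono C w refl refl ∧•-local) (sound d)
sound (∧∘ C φ ψ w d₁ d₂)     =
  mp₂ (fillᵒ-mono₂ C (hole-free C w refl) refl refl refl ∧∘-local) (sound d₁) (sound d₂)
sound (∨• C φ ψ w d₁ d₂)     = mp₂ (fillⁱ-mono₂ C w refl refl refl ∨•-local) (sound d₁) (sound d₂)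
sound (∨∘₁ C φ ψ w d)        = mp (fillᵒ-mono C (hole-free C w refl) refl refl ∨∘₁-local) (sound d)
sound (∨∘₂ C φ ψ w d)        = mp (fillᵒ-mono C (hole-free C w refl) refl refl ∨∘₂-local) (sound d)
sound (⇒• C φ ψ w d₁ d₂)     = mp₂ (fillⁱ-cut C w refl refl refl ⇒•-local) (sound d₁) (sound d₂)
sound (⇒∘ C φ ψ w d)         = mp (fillᵒ-mono C (hole-free C w refl) refl refl ⇒∘-local) (sound d)
sound (□• C φ ψ η Δ w d₁ d₂ d₃) with hasOut Δ in eo
... | false = mp (fillⁱ-mono C w e e (□•-localⁱ φ⟺η eo)) (sound d₃)
  where
  e   = cong (_∨ false) eo
  φ⟺η = interderivable (sound d₁) (sound d₂)
... | true  = mp (fillᵒ-mono C (hole-free C w e) e e (□•-localᵒ φ⟺η eo)) (sound d₃)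
  where
  e   = cong (_∨ false) eo
  φ⟺η = interderivable (sound d₁) (sound d₂)
sound (□∘ C φ ψ w d)         = mp (fillᵒ-mono C (hole-free C w refl) refl refl □∘-local) (sound d)
sound (◇• C φ ψ w d)         = mp (fillⁱ-mono C w refl refl ◇•-local) (sound d)
sound (◇∘ C φ ψ η Δ w d₁ d₂ d₃) with nested-hole C w refl
... | here∘ ([]∷ wΔ []) , oc =
  mp (fillᵒ-mono C oc refl refl (◇∘-local φ⟺η (hasOut-input wΔ))) (sound d₃)
  where φ⟺η = interderivable (sound d₁) (sound d₂)
sound (exch e w d) with ≋-Sem e
... | _ , eA , eS = mp (to (Sem-cong eA eS)) (sound d)

iIn⇒Ant : (w : IsInput Λ) → ⊢ (iIn w ⇒ Ant Λ)
iIn⇒Ant []                                   = ⇒-refl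
iIn⇒Ant (•∷ w)                               = ∧'-map-swap (iIn⇒Ant w) ⇒-refl
iIn⇒Ant ([]∷ w′ w) rewrite hasOut-input w′ = ∧'-map-swap (iIn⇒Ant w) (◇-mono (iIn⇒Ant w′))

mutual
  Sem⇒iN : (w : IsNested Γ) → ⊢ (Sem Γ ⇒ iN w)
  Sem⇒iN w = closed (lam (lam (by (Suc⇒con w) (app v1 (by (ant⇒Ant w) v0)))))

  ant⇒Ant : (w : IsNested Γ) → ⊢ (ant w ⇒ Ant Γ)
  ant⇒Ant (here∘ w)                               = ⇒-trans (iIn⇒Ant w) (from ∧'-identityˡ)
  ant⇒Ant (here[] w′ w) rewrite hasOut-nested w′ = ⇒-trans (iIn⇒Ant w) (from ∧'-identityˡ)
  ant⇒Ant (there• w)                              = ∧'-map-swap (ant⇒Ant w) ⇒-refl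
  ant⇒Ant (there[] w′ w) rewrite hasOut-input w′ = ∧'-map-swap (ant⇒Ant w) (◇-mono (iIn⇒Ant w′))

  Suc⇒con : (w : IsNested Γ) → ⊢ (Suc Γ ⇒ con w)
  Suc⇒con (here∘ {Λ = Λ} w) = to (∨'-absurdʳ (Suc-absurd Λ (hasOut-input w)))
  Suc⇒con (here[] {Λ = Λ} w′ w) rewrite hasOut-nested w′ =
    ⇒-trans (to (∨'-absurdʳ (Suc-absurd Λ (hasOut-input w)))) (□-mono (Sem⇒iN w′))
  Suc⇒con (there• w)                              = ⇒-trans (to ∨'-identityˡ) (Suc⇒con w)
  Suc⇒con (there[] w′ w) rewrite hasOut-input w′ = ⇒-trans (to ∨'-identityˡ) (Suc⇒con w)

theorem1 : ∀ (Γ : Seq) (w : IsNested Γ) → N⊢ Γ → ⊢ iN w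
theorem1 Γ w d = mp (Sem⇒iN w) (sound d)
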